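{- Let $\overrightarrow{C}$ be an oriented ordered cycle of odd length. Then (i) $\overrightarrow{C}$ is directable; (ii) if $\overrightarrow{C}$ is forward directable, then it is not backward directable; (iii) if $\overrightarrow{C}$ is forward directable, then its conjugate is backward directable.
   Context: An ordered cycle $v_1v_2\cdots v_kv_1$ is a cycle together with the traversal order $v_1\to v_2\to\cdots\to v_k\to v_1$; its conjugate is the ordered cycle $v_1v_kv_{k-1}\cdots v_2v_1$. In an orientation, an arc is forward if oriented $v_iv_{i+1}$ (indices mod $k$) and backward otherwise. To push a vertex means to reverse all arcs incident to it. An oriented ordered cycle is forward (resp. backward) directable if some set of its vertices can be pushed so that all arcs become forward (resp. backward), and directable if it is forward or backward directable. -}

module Defs where

open import Data.Nat using (ℕ; zero; suc; _∸_; _≤_; NonZero)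
open import Data.Nat.DivMod using (_%_; m%n<n)
open import Data.Nat.Divisibility using (_∣_)
open import Data.Fin using (Fin; toℕ; fromℕ<)
open import Data.Bool using (Bool; true; false; not; _xor_)
open import Data.Product using (∃)
open import Data.Sum using (_⊎_)
open import Relation.Nullary using (¬_)
open import Relation.Binary.PropositionalEquality using (_≡_)

-- An ordered cycle v_0 v_1 ... v_{k-1} v_0 of length k: its vertices are
-- Fin k (vertex i is v_i) and its edges are {v_i , v_{i+1}} (indices mod k).

next : ∀ {k} → Fin k → Fin k
next {suc n} i = fromℕ< (m%n<n (suc (toℕ i)) (suc n))

rev : ∀ {k} → Fin k → Fin k
rev {suc n} i = fromℕ< (m%n<n (suc n ∸ toℕ i) (suc n))

-- An orientation of the ordered cycle: for each edge index i, the edge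
-- {v_i , v_{i+1}} is oriented v_i → v_{i+1} (forward arc) iff o i ≡ true,
-- and v_{i+1} → v_i (backward arc) iff o i ≡ false.
Orientation : ℕ → Set
Orientation k = Fin k → Bool

-- Pushing the set S of vertices (S v ≡ true iff v ∈ S): every arc incident
-- to a vertex of S is reversed once per pushed endpoint.
push : ∀ {k} → (Fin k → Bool) → Orientation k → Orientation k
push S o i = (o i xor S i) xor S (next i)

ForwardDirectable : ∀ {k} → Orientation k → Set
ForwardDirectable {k} o = ∃ λ (S : Fin k → Bool) → ∀ i → push S o i ≡ true

BackwardDirectable : ∀ {k} → Orientation k → Set
BackwardDirectable {k} o = ∃ λ (S : Fin k → Bool) → ∀ i → push S o i ≡ false

Directable : ∀ {k} → Orientation k → Set
Directable o = ForwardDirectable o ⊎ BackwardDirectable o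

-- The conjugate ordered cycle w_0 w_1 … w_{k-1} w_0 with w_j = v_{rev j}
-- (i.e. v_0 v_{k-1} … v_1 v_0), carrying the same orientation.  Its edge
-- {w_j , w_{j+1}} = {v_{rev (next j)} , v_{rev (next j) + 1}} is the original
-- edge with index rev (next j), whose original forward direction is
-- w_{j+1} → w_j; hence it is forward in the conjugate iff it is backward in
-- the original.
conjugate : ∀ {k} → Orientation k → Orientation k
conjugate o j = not (o (rev (next j)))

Odd : ℕ → Set
Odd k = ¬ (2 ∣ k)

-- Pushing a vertex flips both of its arcs, so the parity of the number of forward arcs
-- (forwardParity) is invariant under pushing. On a cycle of odd length the all-forward
-- orientation has odd parity and the all-backward one even parity, which gives (ii).
-- Conversely, pushing greedily along the path v_0 … v_n makes the first n arcs equal to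
-- that parity, and the invariant then forces the closing arc v_n v_0 as well: this is (i).
-- For (iii), the pushes that direct the cycle forwards also direct its conjugate, which
-- reads every edge in the opposite direction, backwards.

module Submission where

open import Defs
open import Data.Nat using (ℕ; zero; suc; _+_; _*_; _∸_; _≤_; _<_; s≤s)
open import Data.Nat.Properties using (≤-refl; ≤-pred; m<n⇒m<1+n; m≤n⇒m<n∨m≡n; +-∸-assoc; m+n∸n≡m)
open import Data.Nat.DivMod using (_%_; _mod_; %-distribˡ-+; m%n%n≡m%n; [m+n]%n≡m%n; m<n⇒m%n≡m; n%n≡0)
open import Data.Nat.Divisibility using (_∣_; divides; ∣-refl; ∣m∣n⇒∣m+n)
open import Data.Fin using (Fin; toℕ)
open import Data.Fin.Properties using (toℕ-injective; toℕ-fromℕ<; toℕ<n)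
open import Data.Bool using (Bool; true; false; not; _xor_)
open import Data.Bool.Properties using (xor-same; xor-assoc; xor-identityʳ; not-involutive; xor-∧-commutativeRing)
open import Algebra.Bundles using (CommutativeRing)
open import Algebra.Properties.CommutativeSemigroup (CommutativeRing.+-commutativeSemigroup xor-∧-commutativeRing)
  using () renaming (interchange to xor-interchange)
open import Data.Product using (_×_; _,_; ∃)
open import Data.Sum using (inj₁; inj₂)
open import Data.Empty using (⊥-elim)
open import Function using (_∘_)
open import Relation.Nullary using (¬_)
open import Relation.Binary.PropositionalEquality using (_≡_; refl; sym; trans; cong; cong₂; subst; module ≡-Reasoning)
open ≡-Reasoning

parity : (ℕ → Bool) → ℕ → Bool
parity f zero    = false
parity f (suc m) = parity f m xor f m

parity-cong : ∀ {f g : ℕ → Bool} m → (∀ j → j < m → f j ≡ g j) → parity f m ≡ parity g m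
parity-cong zero    _   = refl
parity-cong (suc m) f≡g = cong₂ _xor_ (parity-cong m (λ j j<m → f≡g j (m<n⇒m<1+n j<m))) (f≡g m ≤-refl)

parity-xor : ∀ (f g : ℕ → Bool) m → parity (λ j → f j xor g j) m ≡ parity f m xor parity g m
parity-xor f g zero    = refl
parity-xor f g (suc m) = begin
  parity (λ j → f j xor g j) m xor (f m xor g m)  ≡⟨ cong (_xor (f m xor g m)) (parity-xor f g m) ⟩
  (parity f m xor parity g m) xor (f m xor g m)   ≡⟨ xor-interchange (parity f m) (parity g m) (f m) (g m) ⟩
  (parity f m xor f m) xor (parity g m xor g m)   ∎

parity-telescopes : ∀ (a : ℕ → Bool) m → parity (λ j → a j xor a (suc j)) m ≡ a 0 xor a m
parity-telescopes a zero    = sym (xor-same (a 0))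
parity-telescopes a (suc m) = begin
  parity (λ j → a j xor a (suc j)) m xor (a m xor a (suc m))  ≡⟨ cong (_xor (a m xor a (suc m))) (parity-telescopes a m) ⟩
  (a 0 xor a m) xor (a m xor a (suc m))                       ≡⟨ xor-assoc (a 0) (a m) _ ⟩
  a 0 xor (a m xor (a m xor a (suc m)))                       ≡⟨ cong (a 0 xor_) (sym (xor-assoc (a m) (a m) _)) ⟩
  a 0 xor ((a m xor a m) xor a (suc m))                       ≡⟨ cong (λ x → a 0 xor (x xor a (suc m))) (xor-same (a m)) ⟩
  a 0 xor a (suc m)                                           ∎

parity-const-even : ∀ b {m} → 2 ∣ m → parity (λ _ → b) m ≡ false
parity-const-even b (divides c refl) = parity-const-double c
  where
  parity-const-double : ∀ c → parity (λ _ → b) (c * 2) ≡ false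
  parity-const-double zero    = refl
  parity-const-double (suc c) = begin
    (parity (λ _ → b) (c * 2) xor b) xor b  ≡⟨ cong (λ x → (x xor b) xor b) (parity-const-double c) ⟩
    b xor b                                 ≡⟨ xor-same b ⟩
    false                                   ∎

odd⇒pred-even : ∀ n → Odd (suc n) → 2 ∣ n
odd⇒pred-even zero          _   = divides 0 refl
odd⇒pred-even (suc zero)    odd = ⊥-elim (odd ∣-refl)
odd⇒pred-even (suc (suc n)) odd =
  ∣m∣n⇒∣m+n ∣-refl (odd⇒pred-even n (odd ∘ ∣m∣n⇒∣m+n ∣-refl))

module _ {n : ℕ} where

  toℕ-mod : ∀ m → toℕ (m mod suc n) ≡ m % suc n
  toℕ-mod m = toℕ-fromℕ< _

  mod-cong : ∀ l m → l % suc n ≡ m % suc n → l mod suc n ≡ m mod suc n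
  mod-cong l m eq = toℕ-injective (trans (toℕ-mod l) (trans eq (sym (toℕ-mod m))))

  toℕ-mod-< : ∀ {m} → m < suc n → toℕ (m mod suc n) ≡ m
  toℕ-mod-< {m} m<1+n = trans (toℕ-mod m) (m<n⇒m%n≡m m<1+n)

  mod-toℕ : ∀ (i : Fin (suc n)) → toℕ i mod suc n ≡ i
  mod-toℕ i = toℕ-injective (toℕ-mod-< (toℕ<n i))

  mod-period : suc n mod suc n ≡ 0 mod suc n
  mod-period = mod-cong (suc n) 0 (n%n≡0 (suc n))

  next-mod : ∀ m → next (m mod suc n) ≡ suc m mod suc n
  next-mod m = mod-cong (suc (toℕ (m mod suc n))) (suc m) (begin
    suc (toℕ (m mod suc n)) % suc n         ≡⟨ cong (λ x → suc x % suc n) (toℕ-mod m) ⟩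
    (1 + m % suc n) % suc n                 ≡⟨ %-distribˡ-+ 1 (m % suc n) (suc n) ⟩
    (1 % suc n + m % suc n % suc n) % suc n ≡⟨ cong (λ x → (1 % suc n + x) % suc n) (m%n%n≡m%n m (suc n)) ⟩
    (1 % suc n + m % suc n) % suc n         ≡⟨ sym (%-distribˡ-+ 1 m (suc n)) ⟩
    suc m % suc n                           ∎)

  -- −(t + 1) + 1 ≡ −t modulo suc n, with the negations written as truncated subtractions
  suc-∸-suc-% : ∀ t → t ≤ n → suc (suc n ∸ suc t % suc n) % suc n ≡ (suc n ∸ t) % suc n
  suc-∸-suc-% t t≤n with m≤n⇒m<n∨m≡n t≤n
  ... | inj₁ t<n = begin
    suc (suc n ∸ suc t % suc n) % suc n  ≡⟨ cong (λ x → suc (suc n ∸ x) % suc n) (m<n⇒m%n≡m (s≤s t<n)) ⟩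
    suc (n ∸ t) % suc n                  ≡⟨ cong (_% suc n) (sym (+-∸-assoc 1 t≤n)) ⟩
    (suc n ∸ t) % suc n                  ∎
  ... | inj₂ refl = begin
    suc (suc n ∸ suc n % suc n) % suc n  ≡⟨ cong (λ x → suc (suc n ∸ x) % suc n) (n%n≡0 (suc n)) ⟩
    (1 + suc n) % suc n                  ≡⟨ [m+n]%n≡m%n 1 (suc n) ⟩
    1 % suc n                            ≡⟨ cong (_% suc n) (sym (m+n∸n≡m 1 n)) ⟩
    (suc n ∸ n) % suc n                  ∎

  next-rev-next : ∀ (j : Fin (suc n)) → next (rev (next j)) ≡ rev j
  next-rev-next j = trans (next-mod (suc n ∸ toℕ (next j)))
    (mod-cong (suc (suc n ∸ toℕ (next j))) (suc n ∸ toℕ j) (begin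
    suc (suc n ∸ toℕ (next j)) % suc n            ≡⟨ cong (λ x → suc (suc n ∸ x) % suc n) (toℕ-mod (suc (toℕ j))) ⟩
    suc (suc n ∸ suc (toℕ j) % suc n) % suc n     ≡⟨ suc-∸-suc-% (toℕ j) (≤-pred (toℕ<n j)) ⟩
    (suc n ∸ toℕ j) % suc n                       ∎))

  forwardParity : Orientation (suc n) → Bool
  forwardParity o = parity (λ m → o (m mod suc n)) (suc n)

  forwardParity-push : ∀ S o → forwardParity (push S o) ≡ forwardParity o
  forwardParity-push S o = begin
    parity (λ m → (o [ m ] xor S [ m ]) xor S (next [ m ])) (suc n)
      ≡⟨ parity-cong (suc n) (λ m _ → push-split m) ⟩
    parity (λ m → o [ m ] xor (S [ m ] xor S [ suc m ])) (suc n)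
      ≡⟨ parity-xor (o ∘ [_]) (λ m → S [ m ] xor S [ suc m ]) (suc n) ⟩
    forwardParity o xor parity (λ m → S [ m ] xor S [ suc m ]) (suc n)
      ≡⟨ cong (forwardParity o xor_) (parity-telescopes (S ∘ [_]) (suc n)) ⟩
    forwardParity o xor (S [ 0 ] xor S [ suc n ])
      ≡⟨ cong (λ v → forwardParity o xor (S [ 0 ] xor S v)) mod-period ⟩
    forwardParity o xor (S [ 0 ] xor S [ 0 ])
      ≡⟨ cong (forwardParity o xor_) (xor-same (S [ 0 ])) ⟩
    forwardParity o xor false
      ≡⟨ xor-identityʳ (forwardParity o) ⟩
    forwardParity o ∎
    where
    [_] : ℕ → Fin (suc n)
    [ m ] = m mod suc n

    push-split : ∀ m → push S o [ m ] ≡ o [ m ] xor (S [ m ] xor S [ suc m ])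
    push-split m = trans (xor-assoc (o [ m ]) _ _) (cong (λ v → o [ m ] xor (S [ m ] xor S v)) (next-mod m))

  constant-forwardParity : Odd (suc n) → ∀ {o t} → (∀ i → o i ≡ t) → forwardParity o ≡ t
  constant-forwardParity odd {o} {t} o≡t = begin
    forwardParity o                  ≡⟨ parity-cong (suc n) (λ m _ → o≡t (m mod suc n)) ⟩
    parity (λ _ → t) n xor t         ≡⟨ cong (_xor t) (parity-const-even t (odd⇒pred-even n odd)) ⟩
    t                                ∎

  directed-forwardParity : Odd (suc n) → ∀ S o {t} → (∀ i → push S o i ≡ t) → forwardParity o ≡ t
  directed-forwardParity odd S o directed =
    trans (sym (forwardParity-push S o)) (constant-forwardParity odd directed)

  module Straighten (o : Orientation (suc n)) (t : Bool) where

    potential : ℕ → Bool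
    potential zero    = false
    potential (suc m) = (potential m xor o (m mod suc n)) xor t

    straighten : Fin (suc n) → Bool
    straighten i = potential (toℕ i)

    push-straighten-< : ∀ {m} → m < n → push straighten o (m mod suc n) ≡ t
    push-straighten-< {m} m<n = begin
      (o [m] xor potential (toℕ [m])) xor potential (toℕ (next [m]))
        ≡⟨ cong₂ (λ a b → (o [m] xor potential a) xor potential b)
                 (toℕ-mod-< (m<n⇒m<1+n m<n)) (trans (cong toℕ (next-mod m)) (toℕ-mod-< (s≤s m<n))) ⟩
      (o [m] xor potential m) xor ((potential m xor o [m]) xor t)
        ≡⟨ xor-cancel (o [m]) (potential m) t ⟩
      t ∎
      where
      [m] : Fin (suc n)
      [m] = m mod suc n

      xor-cancel : ∀ x a b → (x xor a) xor ((a xor x) xor b) ≡ b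
      xor-cancel false false b = refl
      xor-cancel false true  b = not-involutive b
      xor-cancel true  false b = not-involutive b
      xor-cancel true  true  b = refl

    push-straighten-last : Odd (suc n) → push straighten o (n mod suc n) ≡ forwardParity o
    push-straighten-last odd = sym (begin
      forwardParity o
        ≡⟨ sym (forwardParity-push straighten o) ⟩
      parity (λ m → push straighten o (m mod suc n)) n xor push straighten o (n mod suc n)
        ≡⟨ cong (_xor push straighten o (n mod suc n)) (parity-cong n (λ _ → push-straighten-<)) ⟩
      parity (λ _ → t) n xor push straighten o (n mod suc n)
        ≡⟨ cong (_xor push straighten o (n mod suc n)) (parity-const-even t (odd⇒pred-even n odd)) ⟩
      push straighten o (n mod suc n) ∎)

  directable-towards-forwardParity : Odd (suc n) → ∀ o → ∃ λ S → ∀ i → push S o i ≡ forwardParity o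
  directable-towards-forwardParity odd o = straighten , λ i →
    subst (λ v → push straighten o v ≡ forwardParity o) (mod-toℕ i) (arc (toℕ i) (≤-pred (toℕ<n i)))
    where
    open Straighten o (forwardParity o)

    arc : ∀ m → m ≤ n → push straighten o (m mod suc n) ≡ forwardParity o
    arc m m≤n with m≤n⇒m<n∨m≡n m≤n
    ... | inj₁ m<n  = push-straighten-< m<n
    ... | inj₂ refl = push-straighten-last odd

  directable : Odd (suc n) → ∀ o → Directable o
  directable odd o with forwardParity o | directable-towards-forwardParity odd o
  ... | true  | directed = inj₁ directed
  ... | false | directed = inj₂ directed

  ¬forward×backward : Odd (suc n) → ∀ o → ForwardDirectable o → ¬ BackwardDirectable o
  ¬forward×backward odd o (S , forward) (T , backward) = true≢false
    (trans (sym (directed-forwardParity odd S o forward)) (directed-forwardParity odd T o backward))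
    where
    true≢false : ¬ true ≡ false
    true≢false ()

  push-conjugate : ∀ S o j → push (S ∘ rev) (conjugate o) j ≡ not (push S o (rev (next j)))
  push-conjugate S o j = begin
    (not (o r) xor S (rev j)) xor S r          ≡⟨ not-xor-swap (o r) (S r) (S (rev j)) ⟩
    not ((o r xor S r) xor S (rev j))          ≡⟨ cong (λ v → not ((o r xor S r) xor S v)) (sym (next-rev-next j)) ⟩
    not ((o r xor S r) xor S (next r))         ∎
    where
    r : Fin (suc n)
    r = rev (next j)

    not-xor-swap : ∀ x a b → (not x xor b) xor a ≡ not ((x xor a) xor b)
    not-xor-swap false false false = refl
    not-xor-swap false false true  = refl
    not-xor-swap false true  false = refl
    not-xor-swap false true  true  = refl
    not-xor-swap true  false false = refl
    not-xor-swap true  false true  = refl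
    not-xor-swap true  true  false = refl
    not-xor-swap true  true  true  = refl

  forward⇒conjugate-backward : ∀ o → ForwardDirectable o → BackwardDirectable (conjugate o)
  forward⇒conjugate-backward o (S , forward) = S ∘ rev , λ j → trans (push-conjugate S o j) (cong not (forward _))

mainTheorem16 : ∀ (k : ℕ) → 3 ≤ k → Odd k → (o : Orientation k) →
    Directable o
    × (ForwardDirectable o → ¬ BackwardDirectable o)
    × (ForwardDirectable o → BackwardDirectable (conjugate o))
-- 3 ≤ k only serves to exclude k = 0.
mainTheorem16 (suc n) _ odd o = directable odd o , ¬forward×backward odd o , forward⇒conjugate-backward o
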